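{- There exist a $2$-$(459,9,4)$ design and a $2$-$(783,9,4)$ design.
   Context: A $2$-$(v,k,\lambda)$ design is a pair $(V,\mathcal{A})$ where $V$ is a set of $v$ points and $\mathcal{A}$ is a collection (multiset) of $k$-subsets of $V$ (blocks) such that every $2$-subset of $V$ is contained in exactly $\lambda$ blocks of $\mathcal{A}$. -}

module Defs where

open import Data.Nat using (ℕ)
open import Data.Fin using (Fin)
open import Data.Fin.Subset using (Subset; _∈_; ∣_∣)
open import Data.Fin.Subset.Properties using (_∈?_)
open import Data.List using (List; length; filter)
open import Data.List.Relation.Unary.All using (All)
open import Data.Product using (_×_; Σ)
open import Relation.Binary.PropositionalEquality using (_≡_; _≢_)
open import Relation.Nullary using (Dec)
open import Relation.Nullary.Decidable using (_×-dec_)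

-- Points are Fin v; a block is a subset of Fin v; the collection of blocks
-- is a List (so repeated blocks are allowed: a multiset).

pairCount : {v : ℕ} → List (Subset v) → Fin v → Fin v → ℕ
pairCount {v} 𝒜 x y = length (filter (λ B → (x ∈? B) ×-dec (y ∈? B)) 𝒜)

Is2Design : (v k λ' : ℕ) → List (Subset v) → Set
Is2Design v k λ' 𝒜 =
  All (λ B → ∣ B ∣ ≡ k) 𝒜 ×
  ((x y : Fin v) → x ≢ y → pairCount 𝒜 x y ≡ λ')

Exists2Design : (v k λ' : ℕ) → Set
Exists2Design v k λ' = Σ (List (Subset v)) (Is2Design v k λ')

module Submission where

-- Both designs come from cyclic difference families, as in the paper.  Two
-- general constructions turn a family satisfying explicit difference
-- conditions into a design; for the concrete families these conditions are
-- finitely many boolean checks, which Agda verifies by evaluation.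
--
-- * Every design below is a list of blocks cut out of Fin v by predicates
--   on ℕ, so a design is reduced to two counting statements about points
--   p < v (`predicateDesign`).
-- * In the cyclic group ℤ_m a set S of residues, translated by all g ∈ ℤ_m,
--   contains the pair {i, j} exactly as often as j − i occurs as a
--   difference c' − c with c, c' ∈ S (`translate-pairs`); a translate of S
--   has |S| elements (`translate-size`).
-- * `TwoOrbits`: points ℤ_m × {0,1} ∪ {∞}; base blocks with the right mixed
--   differences develop into a 2-(2m+1,k,λ) design.  This gives a
--   2-(27,9,4) design from three base blocks over ℤ_13.
-- * `CosetFill`: points ℤ_{ts}; base blocks whose differences avoid the
--   subgroup sℤ_{ts} and cover every other difference λ times, together
--   with a 2-(t,k,λ) design placed on each coset of that subgroup, form a
--   2-(ts,k,λ) design.  With t = 27 this gives 459 = 27·17 and 783 = 27·29.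

open import Data.Bool using (Bool; true; false; _∧_; _∨_; not; if_then_else_; T)
open import Data.Bool.Properties using (∧-identityʳ; ∧-zeroʳ; ∧-comm; T-∧; T-∨; T-not-≡)
open import Data.Fin using (Fin; toℕ; fromℕ<)
open import Data.Fin.Properties using (toℕ-injective; toℕ<n; toℕ-fromℕ<)
open import Data.Fin.Subset using (Subset; ∣_∣)
open import Data.Fin.Subset.Properties using (_∈?_)
open import Data.List using (List; []; _∷_; _++_; map; concatMap; applyUpTo; upTo; length; filter)
open import Data.Bool.ListAction using (all)
open import Data.List.Membership.Propositional.Properties using (∈-upTo⁺)
open import Data.List.Relation.Unary.All as All using (All; []; _∷_)
open import Data.List.Relation.Unary.All.Properties using (all⁺; map⁺; ++⁺; concat⁺; applyUpTo⁺₁)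
open import Data.Nat
  using (ℕ; zero; suc; _+_; _*_; _∸_; _%_; _/_; _≤_; _<_; _≡ᵇ_; _<ᵇ_; s≤s⁻¹; z<s; s<s; NonZero; _≟_; _<?_)
open import Data.Nat.Properties
  using (+-identityʳ; +-assoc; +-comm; suc-injective; ≤-refl; ≤-trans; ≤-antisym; <⇒≤; <⇒≢; ≤⇒≯; ≮⇒≥;
         <-≤-trans; <ᵇ⇒<; ≡ᵇ⇒≡; m≤m+n; m≤n+m; m+n∸m≡n; m+[n∸m]≡n; m∸n+n≡m; m<n+o⇒m∸n<o;
         +-monoʳ-≤; +-monoʳ-<; +-mono-<; +-cancelˡ-≡; m*n≢0; +-commutativeSemigroup)
open import Algebra.Properties.CommutativeSemigroup +-commutativeSemigroup using (interchange; xy∙z≈xz∙y)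
open import Data.Nat.DivMod
  using (m≡m%n+[m/n]*n; m%n%n≡m%n; [m+n]%n≡m%n; [m+kn]%n≡m%n; m≤n⇒[n∸m]%m≡n%m; m%n<n; m<n⇒m%n≡m;
         %-distribˡ-+; m∣n⇒o%n%m≡o%m; m*n/n≡m; m<n⇒m/n≡0; +-distrib-/-∣ˡ; m<n*o⇒m/o<n)
open import Data.Nat.Divisibility using (_∣_; divides)
open import Data.Product using (_×_; _,_; proj₁; proj₂)
open import Data.Sum using (inj₁; inj₂)
open import Data.Vec using (_∷_; []; tabulate; lookup)
open import Data.Vec.Properties using (lookup∘tabulate; tabulate∘lookup; tabulate-cong)
open import Function using (_∘_; const)
open import Function.Bundles using (Equivalence)
open import Relation.Binary.PropositionalEquality
open import Relation.Nullary using (does; yes; no; contradiction)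
open import Relation.Nullary.Decidable using (dec-true; dec-false; _×-dec_)
open import Relation.Unary using (Decidable)

open import Defs

⟦_⟧ : Bool → ℕ
⟦ true ⟧ = 1
⟦ false ⟧ = 0

∑ : ℕ → (ℕ → ℕ) → ℕ
∑ zero f = 0
∑ (suc n) f = f 0 + ∑ n (λ i → f (suc i))

syntax ∑ n (λ i → e) = ∑[ i < n ] e

∑-cong : ∀ n {f g : ℕ → ℕ} → (∀ i → i < n → f i ≡ g i) → ∑ n f ≡ ∑ n g
∑-cong zero e = refl
∑-cong (suc n) e = cong₂ _+_ (e 0 z<s) (∑-cong n (λ i i<n → e (suc i) (s<s i<n)))

∑-+ : ∀ n (f g : ℕ → ℕ) → ∑[ i < n ] (f i + g i) ≡ ∑ n f + ∑ n g
∑-+ zero f g = refl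
∑-+ (suc n) f g =
  trans (cong (f 0 + g 0 +_) (∑-+ n (f ∘ suc) (g ∘ suc)))
        (interchange (f 0) (g 0) (∑ n (f ∘ suc)) (∑ n (g ∘ suc)))

∑-zero : ∀ n {f : ℕ → ℕ} → (∀ i → i < n → f i ≡ 0) → ∑ n f ≡ 0
∑-zero zero z = refl
∑-zero (suc n) z = cong₂ _+_ (z 0 z<s) (∑-zero n (λ i i<n → z (suc i) (s<s i<n)))

∑-single : ∀ n c {f : ℕ → ℕ} → c < n → (∀ i → i < n → i ≢ c → f i ≡ 0) → ∑ n f ≡ f c
∑-single (suc n) zero z<s z =
  trans (cong (_ +_) (∑-zero n (λ i i<n → z (suc i) (s<s i<n) (λ ())))) (+-identityʳ _)
∑-single (suc n) (suc c) (s<s c<n) z =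
  cong₂ _+_ (z 0 z<s (λ ())) (∑-single n c c<n (λ i i<n i≢c → z (suc i) (s<s i<n) (i≢c ∘ suc-injective)))

∑-split : ∀ a b (f : ℕ → ℕ) → ∑ (a + b) f ≡ ∑ a f + ∑[ i < b ] f (a + i)
∑-split zero b f = refl
∑-split (suc a) b f =
  trans (cong (f 0 +_) (∑-split a b (f ∘ suc))) (sym (+-assoc (f 0) _ _))

∑-blocks : ∀ t s (f : ℕ → ℕ) → ∑ (t * s) f ≡ ∑[ j < t ] ∑[ r < s ] f (j * s + r)
∑-blocks zero s f = refl
∑-blocks (suc t) s f = begin
  ∑ (s + t * s) f
    ≡⟨ ∑-split s (t * s) f ⟩
  ∑ s f + ∑[ i < t * s ] f (s + i)
    ≡⟨ cong (∑ s f +_) (∑-blocks t s (λ i → f (s + i))) ⟩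
  ∑ s f + ∑[ j < t ] ∑[ r < s ] f (s + (j * s + r))
    ≡⟨ cong (∑ s f +_) (∑-cong t (λ j _ →
       ∑-cong s (λ r _ → cong f (sym (+-assoc s (j * s) r))))) ⟩
  ∑ s f + ∑[ j < t ] ∑[ r < s ] f (suc j * s + r) ∎
  where open ≡-Reasoning

∑ˡ : {A : Set} → List A → (A → ℕ) → ℕ
∑ˡ [] f = 0
∑ˡ (x ∷ xs) f = f x + ∑ˡ xs f

syntax ∑ˡ xs (λ x → e) = ∑[ x ∈ xs ] e

∑ˡ-cong : {A : Set} {P : A → Set} {xs : List A} {f g : A → ℕ} →
          All P xs → (∀ {x} → P x → f x ≡ g x) → ∑ˡ xs f ≡ ∑ˡ xs g
∑ˡ-cong [] e = refl
∑ˡ-cong (p ∷ ps) e = cong₂ _+_ (e p) (∑ˡ-cong ps e)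

∑ˡ-cong′ : {A : Set} (xs : List A) {f g : A → ℕ} → (∀ x → f x ≡ g x) → ∑ˡ xs f ≡ ∑ˡ xs g
∑ˡ-cong′ [] e = refl
∑ˡ-cong′ (x ∷ xs) e = cong₂ _+_ (e x) (∑ˡ-cong′ xs e)

∑ˡ-++ : {A : Set} (xs ys : List A) (f : A → ℕ) → ∑ˡ (xs ++ ys) f ≡ ∑ˡ xs f + ∑ˡ ys f
∑ˡ-++ [] ys f = refl
∑ˡ-++ (x ∷ xs) ys f = trans (cong (f x +_) (∑ˡ-++ xs ys f)) (sym (+-assoc (f x) _ _))

∑ˡ-concatMap : {A B : Set} (g : A → List B) (xs : List A) (f : B → ℕ) →
               ∑ˡ (concatMap g xs) f ≡ ∑[ x ∈ xs ] ∑ˡ (g x) f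
∑ˡ-concatMap g [] f = refl
∑ˡ-concatMap g (x ∷ xs) f = trans (∑ˡ-++ (g x) (concatMap g xs) f) (cong (∑ˡ (g x) f +_) (∑ˡ-concatMap g xs f))

∑ˡ-map : {A B : Set} (g : A → B) (xs : List A) (f : B → ℕ) → ∑ˡ (map g xs) f ≡ ∑[ x ∈ xs ] f (g x)
∑ˡ-map g [] f = refl
∑ˡ-map g (x ∷ xs) f = cong (f (g x) +_) (∑ˡ-map g xs f)

∑ˡ-applyUpTo : {A : Set} (g : ℕ → A) (n : ℕ) (f : A → ℕ) → ∑ˡ (applyUpTo g n) f ≡ ∑[ i < n ] f (g i)
∑ˡ-applyUpTo g zero f = refl
∑ˡ-applyUpTo g (suc n) f = cong (f (g 0) +_) (∑ˡ-applyUpTo (g ∘ suc) n f)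

∑ˡ-length : {A : Set} (xs : List A) → ∑[ x ∈ xs ] 1 ≡ length xs
∑ˡ-length [] = refl
∑ˡ-length (x ∷ xs) = cong suc (∑ˡ-length xs)

∑ˡ-zero : {A : Set} (xs : List A) {f : A → ℕ} → (∀ x → f x ≡ 0) → ∑ˡ xs f ≡ 0
∑ˡ-zero [] z = refl
∑ˡ-zero (x ∷ xs) z = cong₂ _+_ (z x) (∑ˡ-zero xs z)

_∈ᵇ_ : ℕ → List ℕ → Bool
a ∈ᵇ [] = false
a ∈ᵇ (c ∷ L) = (a ≡ᵇ c) ∨ (a ∈ᵇ L)

residues? : ℕ → List ℕ → Bool
residues? m [] = true
residues? m (c ∷ L) = (c <ᵇ m) ∧ (not (c ∈ᵇ L) ∧ residues? m L)

residues-∷ : ∀ {m c L} → T (residues? m (c ∷ L)) → c < m × (c ∈ᵇ L) ≡ false × T (residues? m L)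
residues-∷ {m} {c} {L} h =
  let c<m , rest = Equivalence.to (T-∧ {c <ᵇ m}) h
      c∉L , L-ok = Equivalence.to (T-∧ {not (c ∈ᵇ L)}) rest
  in <ᵇ⇒< c m c<m , Equivalence.to T-not-≡ c∉L , L-ok

≡⇒≡ᵇ-true : ∀ {a b} → a ≡ b → (a ≡ᵇ b) ≡ true
≡⇒≡ᵇ-true {a} {b} a≡b = dec-true (a ≟ b) a≡b

≡ᵇ-refl : ∀ a → (a ≡ᵇ a) ≡ true
≡ᵇ-refl a = ≡⇒≡ᵇ-true {a} refl

≢⇒≡ᵇ-false : ∀ {a b} → a ≢ b → (a ≡ᵇ b) ≡ false
≢⇒≡ᵇ-false {a} {b} a≢b = dec-false (a ≟ b) a≢b

<ᵇ-true : ∀ {a b} → a < b → (a <ᵇ b) ≡ true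
<ᵇ-true {a} {b} a<b = dec-true (a <? b) a<b

<ᵇ-false : ∀ {a b} → b ≤ a → (a <ᵇ b) ≡ false
<ᵇ-false {a} {b} b≤a = dec-false (a <? b) (≤⇒≯ b≤a)

checked : ∀ {n} (p : ℕ → Bool) → T (all p (upTo n)) → ∀ {d} → d < n → T (p d)
checked p h d<n = All.lookup (all⁺ p _ h) (∈-upTo⁺ d<n)

unless-zero : ∀ {d} {b : Bool} → T ((d ≡ᵇ 0) ∨ b) → d ≢ 0 → T b
unless-zero {d} h d≢0 with Equivalence.to (T-∨ {d ≡ᵇ 0}) h
... | inj₁ d≡0 = contradiction (≡ᵇ⇒≡ d 0 d≡0) d≢0
... | inj₂ b = b

∑-indicator : ∀ n {c} → c < n → (q : ℕ → Bool) → ∑[ a < n ] ⟦ (a ≡ᵇ c) ∧ q a ⟧ ≡ ⟦ q c ⟧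
∑-indicator n {c} c<n q =
  trans (∑-single n c c<n (λ a _ a≢c → cong (λ b → ⟦ b ∧ q a ⟧) (≢⇒≡ᵇ-false a≢c)))
        (cong (λ b → ⟦ b ∧ q c ⟧) (≡ᵇ-refl c))

-- Since c ∉ L, "a = c" and "a ∈ L" never hold together.
indicator-∷ : ∀ a c L b → (c ∈ᵇ L) ≡ false →
              ⟦ ((a ≡ᵇ c) ∨ (a ∈ᵇ L)) ∧ b ⟧ ≡ ⟦ (a ≡ᵇ c) ∧ b ⟧ + ⟦ (a ∈ᵇ L) ∧ b ⟧
indicator-∷ a c L b c∉L with a ≟ c
... | yes refl rewrite ≡ᵇ-refl a | c∉L = sym (+-identityʳ _)
... | no a≢c rewrite ≢⇒≡ᵇ-false a≢c = refl

count-members : ∀ m L → T (residues? m L) → (q : ℕ → Bool) →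
                ∑[ a < m ] ⟦ a ∈ᵇ L ∧ q a ⟧ ≡ ∑[ c ∈ L ] ⟦ q c ⟧
count-members m [] _ q = ∑-zero m (λ _ _ → refl)
count-members m (c ∷ L) h q with residues-∷ {m} {c} {L} h
... | c<m , c∉L , L-ok = begin
  ∑[ a < m ] ⟦ ((a ≡ᵇ c) ∨ (a ∈ᵇ L)) ∧ q a ⟧
    ≡⟨ ∑-cong m (λ a _ → indicator-∷ a c L (q a) c∉L) ⟩
  ∑[ a < m ] (⟦ (a ≡ᵇ c) ∧ q a ⟧ + ⟦ a ∈ᵇ L ∧ q a ⟧)
    ≡⟨ ∑-+ m _ _ ⟩
  ∑[ a < m ] ⟦ (a ≡ᵇ c) ∧ q a ⟧ + ∑[ a < m ] ⟦ a ∈ᵇ L ∧ q a ⟧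
    ≡⟨ cong₂ _+_ (∑-indicator m c<m q) (count-members m L L-ok q) ⟩
  ⟦ q c ⟧ + ∑[ c ∈ L ] ⟦ q c ⟧ ∎
  where open ≡-Reasoning

-- The subset of Fin v cut out by a predicate on ℕ.  All blocks below are
-- of this form, which lets the constructions count with plain numbers.
block : ∀ {v} → (ℕ → Bool) → Subset v
block P = tabulate (P ∘ toℕ)

∣∷∣ : ∀ {v} b (p : Subset v) → ∣ b ∷ p ∣ ≡ ⟦ b ⟧ + ∣ p ∣
∣∷∣ true p = refl
∣∷∣ false p = refl

block-size : ∀ v (P : ℕ → Bool) → ∣ block {v} P ∣ ≡ ∑[ p < v ] ⟦ P p ⟧
block-size zero P = refl
block-size (suc v) P = trans (∣∷∣ (P 0) (block {v} (P ∘ suc))) (cong (⟦ P 0 ⟧ +_) (block-size v (P ∘ suc)))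

-- Lookup in a subset by a natural number (false beyond its length);
-- every subset is the block of its own lookup predicate.
lookupℕ : ∀ {v} → Subset v → ℕ → Bool
lookupℕ [] j = false
lookupℕ (b ∷ p) zero = b
lookupℕ (b ∷ p) (suc j) = lookupℕ p j

lookupℕ-toℕ : ∀ {v} (p : Subset v) (i : Fin v) → lookupℕ p (toℕ i) ≡ lookup p i
lookupℕ-toℕ (b ∷ p) Fin.zero = refl
lookupℕ-toℕ (b ∷ p) (Fin.suc i) = lookupℕ-toℕ p i

subset-size : ∀ {v} (p : Subset v) → ∣ p ∣ ≡ ∑[ j < v ] ⟦ lookupℕ p j ⟧
subset-size {v} p = begin
  ∣ p ∣                        ≡⟨ cong ∣_∣ (sym (tabulate∘lookup p)) ⟩
  ∣ tabulate (lookup p) ∣      ≡⟨ cong ∣_∣ (sym (tabulate-cong (lookupℕ-toℕ p))) ⟩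
  ∣ block {v} (lookupℕ p) ∣    ≡⟨ block-size v (lookupℕ p) ⟩
  ∑[ j < v ] ⟦ lookupℕ p j ⟧   ∎
  where open ≡-Reasoning

∈?-does : ∀ {v} (x : Fin v) (p : Subset v) → does (x ∈? p) ≡ lookup p x
∈?-does Fin.zero (true ∷ p) = refl
∈?-does Fin.zero (false ∷ p) = refl
∈?-does (Fin.suc x) (b ∷ p) = ∈?-does x p

length-filter-∷ : {A : Set} {P : A → Set} (P? : Decidable P) (x : A) (xs : List A) →
                  length (filter P? (x ∷ xs)) ≡ ⟦ does (P? x) ⟧ + length (filter P? xs)
length-filter-∷ P? x xs with does (P? x)
... | true = refl
... | false = refl

pairCount-sum : ∀ {v} (𝒜 : List (Subset v)) (x y : Fin v) →
                pairCount 𝒜 x y ≡ ∑[ B ∈ 𝒜 ] ⟦ lookup B x ∧ lookup B y ⟧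
pairCount-sum [] x y = refl
pairCount-sum (B ∷ 𝒜) x y =
  trans (length-filter-∷ (λ B → (x ∈? B) ×-dec (y ∈? B)) B 𝒜)
        (cong₂ _+_ (cong₂ (λ a b → ⟦ a ∧ b ⟧) (∈?-does x B) (∈?-does y B)) (pairCount-sum 𝒜 x y))

predicateDesign : ∀ v k λ' (Ps : List (ℕ → Bool)) →
                  All (λ P → ∑[ p < v ] ⟦ P p ⟧ ≡ k) Ps →
                  (∀ p q → p < v → q < v → p ≢ q → ∑[ P ∈ Ps ] ⟦ P p ∧ P q ⟧ ≡ λ') →
                  Is2Design v k λ' (map block Ps)
predicateDesign v k λ' Ps sizes pairs = map⁺ (All.map (λ {P} → trans (block-size v P)) sizes) , pairs′
  where
  pairs′ : (x y : Fin v) → x ≢ y → pairCount (map block Ps) x y ≡ λ'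
  pairs′ x y x≢y = begin
    pairCount (map block Ps) x y
      ≡⟨ pairCount-sum (map block Ps) x y ⟩
    ∑[ B ∈ map block Ps ] ⟦ lookup B x ∧ lookup B y ⟧
      ≡⟨ ∑ˡ-map block Ps _ ⟩
    ∑[ P ∈ Ps ] ⟦ lookup (block P) x ∧ lookup (block P) y ⟧
      ≡⟨ ∑ˡ-cong′ Ps (λ P → cong₂ (λ a b → ⟦ a ∧ b ⟧)
         (lookup∘tabulate (P ∘ toℕ) x) (lookup∘tabulate (P ∘ toℕ) y)) ⟩
    ∑[ P ∈ Ps ] ⟦ P (toℕ x) ∧ P (toℕ y) ⟧
      ≡⟨ pairs _ _ (toℕ<n x) (toℕ<n y) (x≢y ∘ toℕ-injective) ⟩
    λ' ∎
    where open ≡-Reasoning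

%-cancel : ∀ {a b d} .{{_ : NonZero d}} → a < d → b < d → (a + b) % d ≡ a → b ≡ 0
%-cancel {a} {b} {d} a<d b<d e with a + b <? d
... | yes a+b<d = +-cancelˡ-≡ a b 0 (trans (sym (m<n⇒m%n≡m a+b<d)) (trans e (sym (+-identityʳ a))))
... | no a+b≮d = contradiction (+-cancelˡ-≡ a b d a+b≡a+d) (<⇒≢ b<d)
  where
  d≤a+b : d ≤ a + b
  d≤a+b = ≮⇒≥ a+b≮d
  wrapped : a + b ∸ d ≡ a
  wrapped = begin
    a + b ∸ d        ≡⟨ m<n⇒m%n≡m (m<n+o⇒m∸n<o (a + b) d (+-mono-< a<d b<d)) ⟨
    (a + b ∸ d) % d  ≡⟨ m≤n⇒[n∸m]%m≡n%m d≤a+b ⟩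
    (a + b) % d      ≡⟨ e ⟩
    a                ∎
    where open ≡-Reasoning
  a+b≡a+d : a + b ≡ a + d
  a+b≡a+d = trans (sym (m∸n+n≡m d≤a+b)) (cong (_+ d) wrapped)

-- Arithmetic in the cyclic group ℤ_m, on representatives 0 … m - 1.
module Cyclic (m : ℕ) {{_ : NonZero m}} where

  diff : ℕ → ℕ → ℕ
  diff i j = (j + m ∸ i) % m

  %-absorbˡ : ∀ a b → (a % m + b) % m ≡ (a + b) % m
  %-absorbˡ a b = begin
    (a % m + b) % m          ≡⟨ %-distribˡ-+ (a % m) b m ⟩
    (a % m % m + b % m) % m  ≡⟨ cong (λ z → (z + b % m) % m) (m%n%n≡m%n a m) ⟩
    (a % m + b % m) % m      ≡⟨ %-distribˡ-+ a b m ⟨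
    (a + b) % m              ∎
    where open ≡-Reasoning

  %-absorbʳ : ∀ a b → (a + b % m) % m ≡ (a + b) % m
  %-absorbʳ a b = trans (cong (_% m) (+-comm a (b % m))) (trans (%-absorbˡ b a) (cong (_% m) (+-comm b a)))

  diff<m : ∀ i j → diff i j < m
  diff<m i j = m%n<n (j + m ∸ i) m

  +-diff : ∀ {i j} → i ≤ m → j < m → (i + diff i j) % m ≡ j
  +-diff {i} {j} i≤m j<m = begin
    (i + (j + m ∸ i) % m) % m  ≡⟨ %-absorbʳ i (j + m ∸ i) ⟩
    (i + (j + m ∸ i)) % m      ≡⟨ cong (_% m) (m+[n∸m]≡n (≤-trans i≤m (m≤n+m m j))) ⟩
    (j + m) % m                ≡⟨ [m+n]%n≡m%n j m ⟩
    j % m                      ≡⟨ m<n⇒m%n≡m j<m ⟩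
    j                          ∎
    where open ≡-Reasoning

  diff-zero : ∀ {i j} → i < m → j < m → diff i j ≡ 0 → i ≡ j
  diff-zero {i} {j} i<m j<m d≡0 = begin
    i                   ≡⟨ m<n⇒m%n≡m i<m ⟨
    i % m               ≡⟨ cong (_% m) (+-identityʳ i) ⟨
    (i + 0) % m         ≡⟨ cong (λ d → (i + d) % m) d≡0 ⟨
    (i + diff i j) % m  ≡⟨ +-diff (<⇒≤ i<m) j<m ⟩
    j                   ∎
    where open ≡-Reasoning

  shift-diff : ∀ {i j} g → i ≤ m → j < m → (j + g) % m ≡ ((i + g) % m + diff i j) % m
  shift-diff {i} {j} g i≤m j<m = begin
    (j + g) % m                    ≡⟨ %-absorbˡ j g ⟨
    (j % m + g) % m                ≡⟨ cong (λ z → (z % m + g) % m) (+-diff i≤m j<m) ⟨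
    ((i + diff i j) % m % m + g) % m ≡⟨ cong (λ z → (z + g) % m) (m%n%n≡m%n (i + diff i j) m) ⟩
    ((i + diff i j) % m + g) % m   ≡⟨ %-absorbˡ (i + diff i j) g ⟩
    (i + diff i j + g) % m         ≡⟨ cong (_% m) (xy∙z≈xz∙y i (diff i j) g) ⟩
    (i + g + diff i j) % m         ≡⟨ %-absorbˡ (i + g) (diff i j) ⟨
    ((i + g) % m + diff i j) % m   ∎
    where open ≡-Reasoning

  rotate : ∀ {i} → i ≤ m → (h : ℕ → ℕ) → ∑[ g < m ] h ((i + g) % m) ≡ ∑ m h
  rotate {i} i≤m h = begin
    ∑ m F                                 ≡⟨ cong (λ z → ∑ z F) (sym r+i≡m) ⟩
    ∑ (r + i) F                           ≡⟨ ∑-split r i F ⟩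
    ∑ r F + ∑[ j < i ] F (r + j)          ≡⟨ cong₂ _+_ (∑-cong r (λ g g<r → cong h (m<n⇒m%n≡m (below g<r))))
                                                        (∑-cong i (λ j j<i → cong h (wraps j<i))) ⟩
    ∑[ g < r ] h (i + g) + ∑ i h          ≡⟨ +-comm _ (∑ i h) ⟩
    ∑ i h + ∑[ g < r ] h (i + g)          ≡⟨ ∑-split i r h ⟨
    ∑ (i + r) h                           ≡⟨ cong (λ z → ∑ z h) (m+[n∸m]≡n i≤m) ⟩
    ∑ m h                                 ∎
    where
    open ≡-Reasoning
    r : ℕ
    r = m ∸ i
    F : ℕ → ℕ
    F g = h ((i + g) % m)
    r+i≡m : r + i ≡ m
    r+i≡m = m∸n+n≡m i≤m
    below : ∀ {g} → g < r → i + g < m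
    below g<r = subst (_ <_) (m+[n∸m]≡n i≤m) (+-monoʳ-< i g<r)
    wraps : ∀ {j} → j < i → (i + (r + j)) % m ≡ j
    wraps {j} j<i = begin
      (i + (r + j)) % m  ≡⟨ cong (_% m) (sym (+-assoc i r j)) ⟩
      (i + r + j) % m    ≡⟨ cong (λ z → (z + j) % m) (m+[n∸m]≡n i≤m) ⟩
      (m + j) % m        ≡⟨ cong (_% m) (+-comm m j) ⟩
      (j + m) % m        ≡⟨ [m+n]%n≡m%n j m ⟩
      j % m              ≡⟨ m<n⇒m%n≡m (<-≤-trans j<i i≤m) ⟩
      j                  ∎

  translate : List ℕ → ℕ → ℕ → Bool
  translate S g p = ((p + g) % m) ∈ᵇ S

  through-point : ∀ S {i} → T (residues? m S) → i ≤ m → (q : ℕ → Bool) →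
                  ∑[ g < m ] ⟦ translate S g i ∧ q ((i + g) % m) ⟧ ≡ ∑[ c ∈ S ] ⟦ q c ⟧
  through-point S S-ok i≤m q = trans (rotate i≤m (λ a → ⟦ a ∈ᵇ S ∧ q a ⟧)) (count-members m S S-ok q)

  translate-size : ∀ S {g} → T (residues? m S) → g ≤ m → ∑[ p < m ] ⟦ translate S g p ⟧ ≡ length S
  translate-size S {g} S-ok g≤m = begin
    ∑[ p < m ] ⟦ ((p + g) % m) ∈ᵇ S ⟧
      ≡⟨ ∑-cong m (λ p _ → cong ⟦_⟧ (trans
         (cong (λ z → (z % m) ∈ᵇ S) (+-comm p g)) (sym (∧-identityʳ _)))) ⟩
    ∑[ p < m ] ⟦ translate S p g ∧ true ⟧
      ≡⟨ through-point S S-ok g≤m (const true) ⟩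
    ∑[ c ∈ S ] 1
      ≡⟨ ∑ˡ-length S ⟩
    length S ∎
    where open ≡-Reasoning

  -- The number of pairs c ∈ S, c' ∈ S' with c' - c = d.
  diffCount : List ℕ → List ℕ → ℕ → ℕ
  diffCount S S' d = ∑[ c ∈ S ] ⟦ translate S' d c ⟧

  translate-pairs : ∀ S S' {i j} → T (residues? m S) → i < m → j < m →
                    ∑[ g < m ] ⟦ translate S g i ∧ translate S' g j ⟧ ≡ diffCount S S' (diff i j)
  translate-pairs S S' {i} {j} S-ok i<m j<m = begin
    ∑[ g < m ] ⟦ translate S g i ∧ translate S' g j ⟧
      ≡⟨ ∑-cong m (λ g _ →
         cong (λ a → ⟦ translate S g i ∧ (a ∈ᵇ S') ⟧)
         (shift-diff g (<⇒≤ i<m) j<m)) ⟩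
    ∑[ g < m ] ⟦ translate S g i ∧ translate S' (diff i j) ((i + g) % m) ⟧
      ≡⟨ through-point S S-ok (<⇒≤ i<m) (translate S' (diff i j)) ⟩
    diffCount S S' (diff i j) ∎
    where open ≡-Reasoning

-- A base block on ℤ_m × {0,1} ∪ {∞}: its residues on the two copies of ℤ_m,
-- and whether it contains ∞.
record BaseBlock : Set where
  constructor base
  field
    left right : List ℕ
    hasInfinity : Bool
open BaseBlock

-- Developing base blocks on ℤ_m × {0,1} ∪ {∞} under ℤ_m.  As numbers,
-- p < m is the point (p, 0), m + i is (i, 1) and m + m is ∞.
module TwoOrbits (m : ℕ) {{_ : NonZero m}} (bases : List BaseBlock) where
  open Cyclic m

  member : BaseBlock → ℕ → ℕ → Bool
  member b g p = if p <ᵇ m then translate (left b) g p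
                 else if p <ᵇ m + m then translate (right b) g (p ∸ m)
                 else hasInfinity b

  blocks : List (ℕ → Bool)
  blocks = concatMap (λ b → applyUpTo (member b) m) bases

  Side : Set
  Side = BaseBlock → List ℕ

  Δ : Side → Side → ℕ → ℕ
  Δ S S' d = ∑[ b ∈ bases ] diffCount (S b) (S' b) d

  ∞-count : Side → ℕ
  ∞-count S = ∑[ b ∈ bases ] ∑[ c ∈ S b ] ⟦ hasInfinity b ⟧

  wellFormed? : ℕ → BaseBlock → Bool
  wellFormed? k b = residues? m (left b) ∧ (residues? m (right b) ∧
                    (length (left b) + length (right b) + ⟦ hasInfinity b ⟧ ≡ᵇ k))

  record Certificate (k λ' : ℕ) : Set where
    field
      wellFormed       : T (all (wellFormed? k) bases)
      pure-left        : T (all (λ d → (d ≡ᵇ 0) ∨ (Δ left left d ≡ᵇ λ')) (upTo m))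
      pure-right       : T (all (λ d → (d ≡ᵇ 0) ∨ (Δ right right d ≡ᵇ λ')) (upTo m))
      mixed-left-right : T (all (λ d → Δ left right d ≡ᵇ λ') (upTo m))
      mixed-right-left : T (all (λ d → Δ right left d ≡ᵇ λ') (upTo m))
      infinity-left    : ∞-count left ≡ λ'
      infinity-right   : ∞-count right ≡ λ'

  data Position : ℕ → Set where
    onLeft     : ∀ {i} → i < m → Position i
    onRight    : ∀ {i} → i < m → Position (m + i)
    atInfinity : Position (m + m)

  position : ∀ {p} → p < m + m + 1 → Position p
  position {p} p<v with p <? m
  ... | yes p<m = onLeft p<m
  ... | no p≮m with p ∸ m <? m
  ...   | yes p∸m<m = subst Position (m+[n∸m]≡n (≮⇒≥ p≮m)) (onRight p∸m<m)
  ...   | no p∸m≮m = subst Position (≤-antisym 2m≤p p≤2m) atInfinity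
    where
    2m≤p : m + m ≤ p
    2m≤p = subst (m + m ≤_) (m+[n∸m]≡n (≮⇒≥ p≮m)) (+-monoʳ-≤ m (≮⇒≥ p∸m≮m))
    p≤2m : p ≤ m + m
    p≤2m = s≤s⁻¹ (subst (p <_) (+-comm (m + m) 1) p<v)

  memberAt : ∀ {p} → BaseBlock → ℕ → Position p → Bool
  memberAt b g (onLeft {i} _)  = translate (left b) g i
  memberAt b g (onRight {i} _) = translate (right b) g i
  memberAt b g atInfinity      = hasInfinity b

  member-at : ∀ b g {p} (π : Position p) → member b g p ≡ memberAt b g π
  member-at b g (onLeft i<m) rewrite <ᵇ-true i<m = refl
  member-at b g (onRight {i} i<m)
    rewrite <ᵇ-false {m + i} (m≤m+n m i) | <ᵇ-true (+-monoʳ-< m i<m) | m+n∸m≡n m i = refl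
  member-at b g atInfinity
    rewrite <ᵇ-false {m + m} (m≤m+n m m) | <ᵇ-false {m + m} {m + m} ≤-refl = refl

  wellFormed-parts : ∀ {k b} → T (wellFormed? k b) →
    T (residues? m (left b)) × T (residues? m (right b)) × length (left b) + length (right b) + ⟦ hasInfinity b ⟧ ≡ k
  wellFormed-parts {k} {b} h =
    let left-ok , rest = Equivalence.to (T-∧ {residues? m (left b)}) h
        right-ok , size = Equivalence.to (T-∧ {residues? m (right b)}) rest
    in left-ok , right-ok , ≡ᵇ⇒≡ _ k size

  member-size : ∀ {k b g} → T (wellFormed? k b) → g ≤ m → ∑[ p < m + m + 1 ] ⟦ member b g p ⟧ ≡ k
  member-size {k} {b} {g} h g≤m = begin
    ∑ (m + m + 1) F
      ≡⟨ ∑-split (m + m) 1 F ⟩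
    ∑ (m + m) F + (F (m + m + 0) + 0)
      ≡⟨ cong₂ _+_ (∑-split m m F)
         (trans (+-identityʳ _) (cong F (+-identityʳ (m + m)))) ⟩
    ∑ m F + ∑[ i < m ] F (m + i) + F (m + m)
      ≡⟨ cong₂ _+_ (cong₂ _+_ left-size right-size)
         (cong ⟦_⟧ (member-at b g atInfinity)) ⟩
    length (left b) + length (right b) + ⟦ hasInfinity b ⟧
      ≡⟨ proj₂ (proj₂ (wellFormed-parts {k} {b} h)) ⟩
    k ∎
    where
    open ≡-Reasoning
    F : ℕ → ℕ
    F p = ⟦ member b g p ⟧
    left-size : ∑ m F ≡ length (left b)
    left-size = trans (∑-cong m (λ i i<m → cong ⟦_⟧ (member-at b g (onLeft i<m))))
                      (translate-size (left b) (proj₁ (wellFormed-parts {k} {b} h)) g≤m)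
    right-size : ∑[ i < m ] F (m + i) ≡ length (right b)
    right-size = trans (∑-cong m (λ i i<m → cong ⟦_⟧ (member-at b g (onRight i<m))))
                       (translate-size (right b) (proj₁ (proj₂ (wellFormed-parts {k} {b} h))) g≤m)

  module Construction {k λ'} (cert : Certificate k λ') where
    open Certificate cert

    ok : All (T ∘ wellFormed? k) bases
    ok = all⁺ (wellFormed? k) bases wellFormed

    left-ok : All (λ b → T (residues? m (left b))) bases
    left-ok = All.map (λ {b} h → proj₁ (wellFormed-parts {k} {b} h)) ok

    right-ok : All (λ b → T (residues? m (right b))) bases
    right-ok = All.map (λ {b} h → proj₁ (proj₂ (wellFormed-parts {k} {b} h))) ok

    pure : ∀ S {i j} → T (all (λ d → (d ≡ᵇ 0) ∨ (Δ S S d ≡ᵇ λ')) (upTo m)) →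
           i < m → j < m → i ≢ j → Δ S S (diff i j) ≡ λ'
    pure S {i} {j} c i<m j<m i≢j =
      ≡ᵇ⇒≡ _ λ' (unless-zero (checked _ c (diff<m i j)) (i≢j ∘ diff-zero i<m j<m))

    mixed : ∀ S S' i j → T (all (λ d → Δ S S' d ≡ᵇ λ') (upTo m)) → Δ S S' (diff i j) ≡ λ'
    mixed S S' i j c = ≡ᵇ⇒≡ _ λ' (checked _ c (diff<m i j))

    side-side : ∀ S S' {i j} → All (λ b → T (residues? m (S b))) bases → i < m → j < m →
      ∑[ b ∈ bases ] ∑[ g < m ] ⟦ translate (S b) g i ∧ translate (S' b) g j ⟧ ≡ Δ S S' (diff i j)
    side-side S S' S-ok i<m j<m = ∑ˡ-cong S-ok (λ {b} h → translate-pairs (S b) (S' b) h i<m j<m)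

    side-∞ : ∀ S {i} → All (λ b → T (residues? m (S b))) bases → i < m →
      ∑[ b ∈ bases ] ∑[ g < m ] ⟦ translate (S b) g i ∧ hasInfinity b ⟧ ≡ ∞-count S
    side-∞ S S-ok i<m = ∑ˡ-cong S-ok (λ {b} h → through-point (S b) h (<⇒≤ i<m) (const (hasInfinity b)))

    ∞-side : ∀ S {i} → All (λ b → T (residues? m (S b))) bases → i < m →
      ∑[ b ∈ bases ] ∑[ g < m ] ⟦ hasInfinity b ∧ translate (S b) g i ⟧ ≡ ∞-count S
    ∞-side S S-ok i<m = trans (∑ˡ-cong′ bases (λ b → ∑-cong m (λ g _ → cong ⟦_⟧ (∧-comm (hasInfinity b) _))))
                              (side-∞ S S-ok i<m)

    pairs-at : ∀ {p q} (πp : Position p) (πq : Position q) → p ≢ q →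
               ∑[ b ∈ bases ] ∑[ g < m ] ⟦ memberAt b g πp ∧ memberAt b g πq ⟧ ≡ λ'
    pairs-at (onLeft i<m)  (onLeft j<m)  p≢q =
      trans (side-side left left left-ok i<m j<m) (pure left pure-left i<m j<m p≢q)
    pairs-at (onLeft {i} i<m)  (onRight {j} j<m) _ =
      trans (side-side left right left-ok i<m j<m) (mixed left right i j mixed-left-right)
    pairs-at (onRight {i} i<m) (onLeft {j} j<m)  _ =
      trans (side-side right left right-ok i<m j<m) (mixed right left i j mixed-right-left)
    pairs-at (onRight i<m) (onRight j<m) p≢q =
      trans (side-side right right right-ok i<m j<m) (pure right pure-right i<m j<m (p≢q ∘ cong (m +_)))
    pairs-at (onLeft i<m)  atInfinity    _   = trans (side-∞ left left-ok i<m) infinity-left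
    pairs-at (onRight i<m) atInfinity    _   = trans (side-∞ right right-ok i<m) infinity-right
    pairs-at atInfinity    (onLeft j<m)  _   = trans (∞-side left left-ok j<m) infinity-left
    pairs-at atInfinity    (onRight j<m) _   = trans (∞-side right right-ok j<m) infinity-right
    pairs-at atInfinity    atInfinity    p≢q = contradiction refl p≢q

    design : Is2Design (m + m + 1) k λ' (map block blocks)
    design = predicateDesign (m + m + 1) k λ' blocks sizes pairs
      where
      sizes : All (λ P → ∑[ p < m + m + 1 ] ⟦ P p ⟧ ≡ k) blocks
      sizes = concat⁺ (map⁺ (All.map (λ {b} h →
                applyUpTo⁺₁ (member b) m (λ g<m → member-size {k} {b} h (<⇒≤ g<m))) ok))
      pairs : ∀ p q → p < m + m + 1 → q < m + m + 1 → p ≢ q → ∑[ P ∈ blocks ] ⟦ P p ∧ P q ⟧ ≡ λ'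
      pairs p q p<v q<v p≢q = begin
        ∑[ P ∈ blocks ] ⟦ P p ∧ P q ⟧
          ≡⟨ ∑ˡ-concatMap _ bases _ ⟩
        ∑[ b ∈ bases ] ∑[ P ∈ applyUpTo (member b) m ] ⟦ P p ∧ P q ⟧
          ≡⟨ ∑ˡ-cong′ bases (λ b → ∑ˡ-applyUpTo (member b) m _) ⟩
        ∑[ b ∈ bases ] ∑[ g < m ] ⟦ member b g p ∧ member b g q ⟧
          ≡⟨ ∑ˡ-cong′ bases (λ b → ∑-cong m (λ g _ →
             cong₂ (λ x y → ⟦ x ∧ y ⟧) (member-at b g πp) (member-at b g πq))) ⟩
        ∑[ b ∈ bases ] ∑[ g < m ] ⟦ memberAt b g πp ∧ memberAt b g πq ⟧
          ≡⟨ pairs-at πp πq p≢q ⟩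
        λ' ∎
        where
        open ≡-Reasoning
        πp : Position p
        πp = position p<v
        πq : Position q
        πq = position q<v

-- As numbers,
-- the point p lies in the coset p % s, at index p / s within it.
module CosetFill (t s : ℕ) {{_ : NonZero t}} {{_ : NonZero s}} (bases : List (List ℕ)) (L : List (Subset t)) where
  n : ℕ
  n = t * s

  instance
    n≢0 : NonZero n
    n≢0 = m*n≢0 t s

  open Cyclic n

  lift : ℕ → Subset t → ℕ → Bool
  lift r β p = (p % s ≡ᵇ r) ∧ lookupℕ β (p / s)

  blocks : List (ℕ → Bool)
  blocks = concatMap (λ S → applyUpTo (translate S) n) bases ++ concatMap (λ r → map (lift r) L) (upTo s)

  Δ : ℕ → ℕ
  Δ d = ∑[ S ∈ bases ] diffCount S S d

  wellFormed? : ℕ → List ℕ → Bool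
  wellFormed? k S = residues? n S ∧ (length S ≡ᵇ k)

  record Certificate (k λ' : ℕ) : Set where
    field
      wellFormed  : T (all (wellFormed? k) bases)
      differences : T (all (λ d → (d ≡ᵇ 0) ∨ (Δ d ≡ᵇ (if d % s ≡ᵇ 0 then 0 else λ'))) (upTo n))

  s∣n : s ∣ n
  s∣n = divides t refl

  coset-diff : ∀ {x y} → x < n → y < n → y % s ≡ (x % s + diff x y % s) % s
  coset-diff {x} {y} x<n y<n = begin
    y % s                       ≡⟨ cong (_% s) (+-diff (<⇒≤ x<n) y<n) ⟨
    (x + diff x y) % n % s      ≡⟨ m∣n⇒o%n%m≡o%m s n (x + diff x y) s∣n ⟩
    (x + diff x y) % s          ≡⟨ %-distribˡ-+ x (diff x y) s ⟩
    (x % s + diff x y % s) % s  ∎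
    where open ≡-Reasoning

  same-coset : ∀ {x y} → x < n → y < n → diff x y % s ≡ 0 → x % s ≡ y % s
  same-coset {x} {y} x<n y<n d≡0 = sym (begin
    y % s                       ≡⟨ coset-diff x<n y<n ⟩
    (x % s + diff x y % s) % s  ≡⟨ cong (λ z → (x % s + z) % s) d≡0 ⟩
    (x % s + 0) % s             ≡⟨ cong (_% s) (+-identityʳ (x % s)) ⟩
    x % s % s                   ≡⟨ m%n%n≡m%n x s ⟩
    x % s                       ∎)
    where open ≡-Reasoning

  same-coset⁻¹ : ∀ {x y} → x < n → y < n → x % s ≡ y % s → diff x y % s ≡ 0
  same-coset⁻¹ {x} {y} x<n y<n e =
    %-cancel (m%n<n x s) (m%n<n (diff x y) s) (sym (trans e (coset-diff x<n y<n)))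

  index : ∀ {x} → x < n → Fin t
  index x<n = fromℕ< (m<n*o⇒m/o<n x<n)

  lookup-index : ∀ {x} (x<n : x < n) (β : Subset t) → lookup β (index x<n) ≡ lookupℕ β (x / s)
  lookup-index x<n β = trans (sym (lookupℕ-toℕ β (index x<n))) (cong (lookupℕ β) (toℕ-fromℕ< _))

  index-injective : ∀ {x y} (x<n : x < n) (y<n : y < n) → x % s ≡ y % s → index x<n ≡ index y<n → x ≡ y
  index-injective {x} {y} x<n y<n same-r same-i = begin
    x                      ≡⟨ m≡m%n+[m/n]*n x s ⟩
    x % s + (x / s) * s    ≡⟨ cong₂ (λ r j → r + j * s) same-r same-j ⟩
    y % s + (y / s) * s    ≡⟨ m≡m%n+[m/n]*n y s ⟨
    y                      ∎
    where
    open ≡-Reasoning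
    same-j : x / s ≡ y / s
    same-j = trans (sym (toℕ-fromℕ< _)) (trans (cong toℕ same-i) (toℕ-fromℕ< _))

  lift-size : ∀ {r} → r < s → (β : Subset t) → ∑[ p < n ] ⟦ lift r β p ⟧ ≡ ∣ β ∣
  lift-size {r} r<s β = begin
    ∑[ p < t * s ] ⟦ lift r β p ⟧
      ≡⟨ ∑-blocks t s _ ⟩
    ∑[ j < t ] ∑[ r' < s ] ⟦ lift r β (j * s + r') ⟧
      ≡⟨ ∑-cong t (λ j _ → ∑-cong s (λ r' r'<s →
         cong₂ (λ u w → ⟦ (u ≡ᵇ r) ∧ lookupℕ β w ⟧) (coset {j} r'<s) (idx {j} r'<s))) ⟩
    ∑[ j < t ] ∑[ r' < s ] ⟦ (r' ≡ᵇ r) ∧ lookupℕ β j ⟧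
      ≡⟨ ∑-cong t (λ j _ → ∑-indicator s r<s (λ _ → lookupℕ β j)) ⟩
    ∑[ j < t ] ⟦ lookupℕ β j ⟧
      ≡⟨ subset-size β ⟨
    ∣ β ∣ ∎
    where
    open ≡-Reasoning
    coset : ∀ {j r'} → r' < s → (j * s + r') % s ≡ r'
    coset {j} {r'} r'<s = trans (cong (_% s) (+-comm (j * s) r')) (trans ([m+kn]%n≡m%n r' j s) (m<n⇒m%n≡m r'<s))
    idx : ∀ {j r'} → r' < s → (j * s + r') / s ≡ j
    idx {j} {r'} r'<s = begin
      (j * s + r') / s      ≡⟨ +-distrib-/-∣ˡ r' (divides j refl) ⟩
      j * s / s + r' / s    ≡⟨ cong₂ _+_ (m*n/n≡m j s) (m<n⇒m/n≡0 r'<s) ⟩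
      j + 0                 ≡⟨ +-identityʳ j ⟩
      j                     ∎

  fill : ℕ → ℕ → ℕ
  fill x y = ∑[ r < s ] ∑[ β ∈ L ] ⟦ lift r β x ∧ lift r β y ⟧

  fill-apart : ∀ {x y} → x % s ≢ y % s → fill x y ≡ 0
  fill-apart {x} {y} apart = ∑-zero s (λ r _ → ∑ˡ-zero L (λ β → cong ⟦_⟧ (no-block r β)))
    where
    no-block : ∀ r β → lift r β x ∧ lift r β y ≡ false
    no-block r β with x % s ≟ r
    ... | no x≢r rewrite ≢⇒≡ᵇ-false x≢r = refl
    ... | yes refl rewrite ≡ᵇ-refl (x % s) | ≢⇒≡ᵇ-false (apart ∘ sym) = ∧-zeroʳ _

  -- Distinct points of one coset lie together in λ' fill blocks, namely in
  -- the copies of the blocks of L through their indices.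
  fill-together : ∀ {k λ' x y} → Is2Design t k λ' L → (x<n : x < n) (y<n : y < n) → x ≢ y → x % s ≡ y % s →
                  fill x y ≡ λ'
  fill-together {k} {λ'} {x} {y} L-design x<n y<n x≢y same-r = begin
    fill x y
      ≡⟨ ∑-single s (x % s) (m%n<n x s) off-coset ⟩
    ∑[ β ∈ L ] ⟦ lift (x % s) β x ∧ lift (x % s) β y ⟧
      ≡⟨ ∑ˡ-cong′ L on-coset ⟩
    ∑[ β ∈ L ] ⟦ lookup β (index x<n) ∧ lookup β (index y<n) ⟧
      ≡⟨ pairCount-sum L (index x<n) (index y<n) ⟨
    pairCount L (index x<n) (index y<n)
      ≡⟨ proj₂ L-design _ _ (x≢y ∘ index-injective x<n y<n same-r) ⟩
    λ' ∎
    where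
    open ≡-Reasoning
    off-coset : ∀ r → r < s → r ≢ x % s → ∑[ β ∈ L ] ⟦ lift r β x ∧ lift r β y ⟧ ≡ 0
    off-coset r _ r≢x =
      ∑ˡ-zero L (λ β → cong (λ b → ⟦ (b ∧ lookupℕ β (x / s)) ∧ lift r β y ⟧) (≢⇒≡ᵇ-false (r≢x ∘ sym)))
    on-coset : ∀ β → ⟦ lift (x % s) β x ∧ lift (x % s) β y ⟧ ≡ ⟦ lookup β (index x<n) ∧ lookup β (index y<n) ⟧
    on-coset β rewrite ≡ᵇ-refl (x % s) | same-r | ≡ᵇ-refl (y % s) | lookup-index x<n β | lookup-index y<n β = refl

  module Construction {k λ'} (cert : Certificate k λ') (L-design : Is2Design t k λ' L) where
    open Certificate cert

    ok : All (T ∘ wellFormed? k) bases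
    ok = all⁺ (wellFormed? k) bases wellFormed

    residues-ok′ : ∀ {S} → T (wellFormed? k S) → T (residues? n S)
    residues-ok′ {S} h = proj₁ (Equivalence.to (T-∧ {residues? n S}) h)

    residues-ok : All (T ∘ residues? n) bases
    residues-ok = All.map (λ {S} → residues-ok′ {S}) ok

    size-ok : ∀ {S} → T (wellFormed? k S) → length S ≡ k
    size-ok {S} h = ≡ᵇ⇒≡ _ k (proj₂ (Equivalence.to (T-∧ {residues? n S}) h))

    Δ-certified : ∀ {x y} → x < n → y < n → x ≢ y → Δ (diff x y) ≡ (if diff x y % s ≡ᵇ 0 then 0 else λ')
    Δ-certified {x} {y} x<n y<n x≢y =
      ≡ᵇ⇒≡ _ _ (unless-zero (checked _ differences (diff<m x y)) (x≢y ∘ diff-zero x<n y<n))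

    Δ-within : ∀ {x y} → x < n → y < n → x ≢ y → diff x y % s ≡ 0 → Δ (diff x y) ≡ 0
    Δ-within x<n y<n x≢y d≡0 = trans (Δ-certified x<n y<n x≢y) (cong (λ b → if b then 0 else λ') (≡⇒≡ᵇ-true d≡0))

    Δ-across : ∀ {x y} → x < n → y < n → x ≢ y → diff x y % s ≢ 0 → Δ (diff x y) ≡ λ'
    Δ-across x<n y<n x≢y d≢0 = trans (Δ-certified x<n y<n x≢y) (cong (λ b → if b then 0 else λ') (≢⇒≡ᵇ-false d≢0))

    pairs-split : ∀ {x y} → x < n → y < n → ∑[ P ∈ blocks ] ⟦ P x ∧ P y ⟧ ≡ Δ (diff x y) + fill x y
    pairs-split {x} {y} x<n y<n = trans (∑ˡ-++ developedBlocks fillBlocks _) (cong₂ _+_ developed-sum fill-sum)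
      where
      developedBlocks fillBlocks : List (ℕ → Bool)
      developedBlocks = concatMap (λ S → applyUpTo (translate S) n) bases
      fillBlocks = concatMap (λ r → map (lift r) L) (upTo s)
      developed-sum : ∑[ P ∈ developedBlocks ] ⟦ P x ∧ P y ⟧ ≡ Δ (diff x y)
      developed-sum = begin
        ∑[ P ∈ developedBlocks ] ⟦ P x ∧ P y ⟧
          ≡⟨ ∑ˡ-concatMap _ bases _ ⟩
        ∑[ S ∈ bases ] ∑[ P ∈ applyUpTo (translate S) n ] ⟦ P x ∧ P y ⟧
          ≡⟨ ∑ˡ-cong′ bases (λ S → ∑ˡ-applyUpTo (translate S) n _) ⟩
        ∑[ S ∈ bases ] ∑[ g < n ] ⟦ translate S g x ∧ translate S g y ⟧
          ≡⟨ ∑ˡ-cong residues-ok (λ {S} h → translate-pairs S S h x<n y<n) ⟩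
        Δ (diff x y) ∎
        where open ≡-Reasoning
      fill-sum : ∑[ P ∈ fillBlocks ] ⟦ P x ∧ P y ⟧ ≡ fill x y
      fill-sum = begin
        ∑[ P ∈ fillBlocks ] ⟦ P x ∧ P y ⟧
          ≡⟨ ∑ˡ-concatMap _ (upTo s) _ ⟩
        ∑[ r ∈ upTo s ] ∑[ P ∈ map (lift r) L ] ⟦ P x ∧ P y ⟧
          ≡⟨ ∑ˡ-cong′ (upTo s) (λ r → ∑ˡ-map (lift r) L _) ⟩
        ∑[ r ∈ upTo s ] ∑[ β ∈ L ] ⟦ lift r β x ∧ lift r β y ⟧
          ≡⟨ ∑ˡ-applyUpTo (λ r → r) s _ ⟩
        fill x y ∎
        where open ≡-Reasoning

    -- Points in one coset are joined only by fill blocks, points in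
    -- different cosets only by developed blocks.
    pairs : ∀ x y → x < n → y < n → x ≢ y → ∑[ P ∈ blocks ] ⟦ P x ∧ P y ⟧ ≡ λ'
    pairs x y x<n y<n x≢y with diff x y % s ≟ 0
    ... | yes d≡0 = trans (pairs-split x<n y<n)
                          (cong₂ _+_ (Δ-within x<n y<n x≢y d≡0) (fill-together L-design x<n y<n x≢y (same-coset x<n y<n d≡0)))
    ... | no d≢0 = trans (pairs-split x<n y<n)
                         (trans (cong₂ _+_ (Δ-across x<n y<n x≢y d≢0) (fill-apart (d≢0 ∘ same-coset⁻¹ x<n y<n)))
                                (+-identityʳ λ'))

    design : Is2Design n k λ' (map block blocks)
    design = predicateDesign n k λ' blocks (++⁺ developed-sizes fill-sizes) pairs
      where
      developed-sizes : All (λ P → ∑[ p < n ] ⟦ P p ⟧ ≡ k) (concatMap (λ S → applyUpTo (translate S) n) bases)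
      developed-sizes = concat⁺ (map⁺ (All.map (λ {S} h → applyUpTo⁺₁ (translate S) n (λ g<n →
                          trans (translate-size S (residues-ok′ {S} h) (<⇒≤ g<n)) (size-ok {S} h))) ok))
      fill-sizes : All (λ P → ∑[ p < n ] ⟦ P p ⟧ ≡ k) (concatMap (λ r → map (lift r) L) (upTo s))
      fill-sizes = concat⁺ (map⁺ (applyUpTo⁺₁ (λ r → r) s (λ r<s →
                     map⁺ (All.map (λ {β} → trans (lift-size r<s β)) (proj₁ L-design)))))

bases27 : List BaseBlock
bases27 = base (0 ∷ 1 ∷ 2 ∷ 3 ∷ 6 ∷ 10 ∷ []) (4 ∷ 9 ∷ 11 ∷ []) false
        ∷ base (4 ∷ 9 ∷ 11 ∷ []) (0 ∷ 1 ∷ 2 ∷ 3 ∷ 6 ∷ 10 ∷ []) false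
        ∷ base (0 ∷ 1 ∷ 3 ∷ 9 ∷ []) (0 ∷ 1 ∷ 3 ∷ 9 ∷ []) true
        ∷ []

certificate27 : TwoOrbits.Certificate 13 bases27 9 4
certificate27 = record
  { wellFormed = _ ; pure-left = _ ; pure-right = _ ; mixed-left-right = _ ; mixed-right-left = _
  ; infinity-left = refl ; infinity-right = refl }

design27 : Exists2Design 27 9 4
design27 = _ , TwoOrbits.Construction.design 13 bases27 certificate27

bases459 : List (List ℕ)
bases459 =
  (3 ∷ 46 ∷ 69 ∷ 164 ∷ 263 ∷ 295 ∷ 330 ∷ 345 ∷ 422 ∷ []) ∷
  (56 ∷ 57 ∷ 101 ∷ 129 ∷ 262 ∷ 303 ∷ 368 ∷ 393 ∷ 403 ∷ []) ∷
  (123 ∷ 156 ∷ 160 ∷ 165 ∷ 235 ∷ 236 ∷ 249 ∷ 260 ∷ 299 ∷ []) ∷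
  (42 ∷ 44 ∷ 47 ∷ 133 ∷ 141 ∷ 181 ∷ 210 ∷ 326 ∷ 381 ∷ []) ∷
  (71 ∷ 73 ∷ 79 ∷ 128 ∷ 318 ∷ 339 ∷ 354 ∷ 380 ∷ 384 ∷ []) ∷
  (15 ∷ 29 ∷ 75 ∷ 125 ∷ 290 ∷ 300 ∷ 316 ∷ 411 ∷ 430 ∷ []) ∷
  (6 ∷ 48 ∷ 155 ∷ 192 ∷ 214 ∷ 233 ∷ 245 ∷ 285 ∷ 343 ∷ []) ∷
  (114 ∷ 218 ∷ 241 ∷ 344 ∷ 366 ∷ 397 ∷ 435 ∷ 449 ∷ 453 ∷ []) ∷
  (4 ∷ 22 ∷ 31 ∷ 118 ∷ 146 ∷ 289 ∷ 415 ∷ 438 ∷ 443 ∷ []) ∷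
  (60 ∷ 173 ∷ 253 ∷ 265 ∷ 289 ∷ 308 ∷ 382 ∷ 388 ∷ 436 ∷ []) ∷
  (38 ∷ 64 ∷ 220 ∷ 222 ∷ 227 ∷ 289 ∷ 292 ∷ 328 ∷ 334 ∷ []) ∷
  (87 ∷ 112 ∷ 145 ∷ 226 ∷ 289 ∷ 335 ∷ 346 ∷ 355 ∷ 416 ∷ []) ∷
  (10 ∷ 92 ∷ 139 ∷ 166 ∷ 254 ∷ 276 ∷ 289 ∷ 307 ∷ 454 ∷ []) ∷
  (37 ∷ 65 ∷ 172 ∷ 193 ∷ 195 ∷ 211 ∷ 247 ∷ 289 ∷ 389 ∷ []) ∷
  (11 ∷ 33 ∷ 91 ∷ 184 ∷ 200 ∷ 289 ∷ 301 ∷ 361 ∷ 409 ∷ []) ∷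
  (58 ∷ 130 ∷ 168 ∷ 199 ∷ 274 ∷ 280 ∷ 281 ∷ 289 ∷ 362 ∷ []) ∷
  (46 ∷ 100 ∷ 161 ∷ 306 ∷ 330 ∷ 341 ∷ 362 ∷ 373 ∷ 394 ∷ []) ∷
  (49 ∷ 146 ∷ 206 ∷ 262 ∷ 303 ∷ 306 ∷ 370 ∷ 448 ∷ 458 ∷ []) ∷
  (97 ∷ 134 ∷ 173 ∷ 235 ∷ 249 ∷ 306 ∷ 319 ∷ 395 ∷ 451 ∷ []) ∷
  (141 ∷ 154 ∷ 181 ∷ 227 ∷ 306 ∷ 313 ∷ 314 ∷ 400 ∷ 404 ∷ []) ∷
  (19 ∷ 26 ∷ 73 ∷ 103 ∷ 152 ∷ 286 ∷ 306 ∷ 335 ∷ 384 ∷ []) ∷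
  (92 ∷ 188 ∷ 208 ∷ 232 ∷ 287 ∷ 306 ∷ 316 ∷ 411 ∷ 427 ∷ []) ∷
  (6 ∷ 53 ∷ 65 ∷ 98 ∷ 124 ∷ 127 ∷ 157 ∷ 306 ∷ 343 ∷ []) ∷
  (11 ∷ 76 ∷ 114 ∷ 179 ∷ 242 ∷ 306 ∷ 367 ∷ 397 ∷ 424 ∷ []) ∷ []

certificate459 : CosetFill.Certificate 27 17 bases459 (proj₁ design27) 9 4
certificate459 = record { wellFormed = _ ; differences = _ }

bases783 : List (List ℕ)
bases783 =
  (44 ∷ 289 ∷ 397 ∷ 453 ∷ 485 ∷ 502 ∷ 578 ∷ 651 ∷ 667 ∷ []) ∷
  (26 ∷ 370 ∷ 507 ∷ 516 ∷ 529 ∷ 611 ∷ 659 ∷ 667 ∷ 721 ∷ []) ∷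
  (100 ∷ 200 ∷ 262 ∷ 530 ∷ 539 ∷ 637 ∷ 667 ∷ 723 ∷ 759 ∷ []) ∷
  (21 ∷ 165 ∷ 206 ∷ 242 ∷ 286 ∷ 613 ∷ 667 ∷ 713 ∷ 748 ∷ []) ∷
  (138 ∷ 208 ∷ 345 ∷ 416 ∷ 448 ∷ 451 ∷ 476 ∷ 620 ∷ 667 ∷ []) ∷
  (11 ∷ 30 ∷ 75 ∷ 313 ∷ 397 ∷ 566 ∷ 586 ∷ 667 ∷ 773 ∷ []) ∷
  (343 ∷ 350 ∷ 370 ∷ 381 ∷ 395 ∷ 556 ∷ 561 ∷ 667 ∷ 740 ∷ []) ∷
  (154 ∷ 156 ∷ 219 ∷ 262 ∷ 269 ∷ 449 ∷ 524 ∷ 667 ∷ 745 ∷ []) ∷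
  (102 ∷ 181 ∷ 354 ∷ 443 ∷ 613 ∷ 665 ∷ 667 ∷ 718 ∷ 728 ∷ []) ∷
  (111 ∷ 119 ∷ 215 ∷ 289 ∷ 451 ∷ 610 ∷ 667 ∷ 669 ∷ 746 ∷ []) ∷
  (178 ∷ 287 ∷ 389 ∷ 512 ∷ 586 ∷ 588 ∷ 667 ∷ 705 ∷ 721 ∷ []) ∷
  (16 ∷ 17 ∷ 100 ∷ 134 ∷ 264 ∷ 343 ∷ 667 ∷ 686 ∷ 732 ∷ []) ∷
  (57 ∷ 151 ∷ 154 ∷ 188 ∷ 308 ∷ 503 ∷ 534 ∷ 667 ∷ 748 ∷ []) ∷
  (48 ∷ 98 ∷ 181 ∷ 208 ∷ 362 ∷ 404 ∷ 489 ∷ 667 ∷ 691 ∷ []) ∷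
  (148 ∷ 198 ∷ 363 ∷ 374 ∷ 422 ∷ 645 ∷ 648 ∷ 725 ∷ 774 ∷ []) ∷
  (9 ∷ 104 ∷ 147 ∷ 243 ∷ 418 ∷ 557 ∷ 725 ∷ 747 ∷ 753 ∷ []) ∷
  (36 ∷ 66 ∷ 189 ∷ 314 ∷ 402 ∷ 590 ∷ 639 ∷ 715 ∷ 725 ∷ []) ∷
  (125 ∷ 144 ∷ 185 ∷ 207 ∷ 337 ∷ 525 ∷ 564 ∷ 725 ∷ 756 ∷ []) ∷
  (12 ∷ 45 ∷ 131 ∷ 152 ∷ 391 ∷ 429 ∷ 576 ∷ 675 ∷ 725 ∷ []) ∷
  (180 ∷ 260 ∷ 309 ∷ 351 ∷ 607 ∷ 672 ∷ 698 ∷ 725 ∷ 738 ∷ []) ∷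
  (78 ∷ 603 ∷ 617 ∷ 621 ∷ 688 ∷ 692 ∷ 714 ∷ 720 ∷ 725 ∷ []) ∷
  (51 ∷ 63 ∷ 71 ∷ 135 ∷ 229 ∷ 293 ∷ 531 ∷ 725 ∷ 768 ∷ []) ∷
  (201 ∷ 252 ∷ 540 ∷ 558 ∷ 563 ∷ 719 ∷ 725 ∷ 726 ∷ 742 ∷ []) ∷
  (77 ∷ 179 ∷ 225 ∷ 282 ∷ 294 ∷ 445 ∷ 594 ∷ 666 ∷ 725 ∷ []) ∷
  (27 ∷ 40 ∷ 117 ∷ 132 ∷ 315 ∷ 368 ∷ 482 ∷ 606 ∷ 725 ∷ []) ∷
  (108 ∷ 267 ∷ 336 ∷ 341 ∷ 468 ∷ 477 ∷ 536 ∷ 725 ∷ 769 ∷ []) ∷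
  (24 ∷ 39 ∷ 233 ∷ 306 ∷ 342 ∷ 432 ∷ 553 ∷ 725 ∷ 752 ∷ []) ∷
  (50 ∷ 162 ∷ 417 ∷ 441 ∷ 472 ∷ 584 ∷ 585 ∷ 618 ∷ 725 ∷ []) ∷
  (33 ∷ 54 ∷ 66 ∷ 75 ∷ 364 ∷ 483 ∷ 500 ∷ 517 ∷ 595 ∷ []) ∷
  (105 ∷ 216 ∷ 328 ∷ 379 ∷ 499 ∷ 525 ∷ 561 ∷ 608 ∷ 654 ∷ []) ∷
  (6 ∷ 12 ∷ 81 ∷ 156 ∷ 159 ∷ 256 ∷ 257 ∷ 298 ∷ 355 ∷ []) ∷
  (67 ∷ 102 ∷ 309 ∷ 324 ∷ 375 ∷ 419 ∷ 463 ∷ 546 ∷ 757 ∷ []) ∷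
  (94 ∷ 112 ∷ 244 ∷ 284 ∷ 357 ∷ 456 ∷ 513 ∷ 669 ∷ 714 ∷ []) ∷
  (202 ∷ 274 ∷ 384 ∷ 486 ∷ 527 ∷ 541 ∷ 588 ∷ 768 ∷ 780 ∷ []) ∷
  (139 ∷ 163 ∷ 201 ∷ 264 ∷ 378 ∷ 492 ∷ 510 ∷ 634 ∷ 716 ∷ []) ∷
  (13 ∷ 141 ∷ 213 ∷ 217 ∷ 282 ∷ 382 ∷ 534 ∷ 689 ∷ 729 ∷ []) ∷
  (48 ∷ 303 ∷ 433 ∷ 567 ∷ 571 ∷ 581 ∷ 591 ∷ 606 ∷ 661 ∷ []) ∷
  (121 ∷ 149 ∷ 168 ∷ 336 ∷ 453 ∷ 514 ∷ 537 ∷ 544 ∷ 702 ∷ []) ∷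
  (39 ∷ 55 ∷ 310 ∷ 321 ∷ 411 ∷ 436 ∷ 459 ∷ 507 ∷ 770 ∷ []) ∷
  (4 ∷ 122 ∷ 240 ∷ 270 ∷ 283 ∷ 417 ∷ 568 ∷ 600 ∷ 723 ∷ []) ∷
  (21 ∷ 175 ∷ 271 ∷ 297 ∷ 363 ∷ 573 ∷ 625 ∷ 662 ∷ 699 ∷ []) ∷
  (147 ∷ 186 ∷ 345 ∷ 405 ∷ 465 ∷ 473 ∷ 526 ∷ 649 ∷ 760 ∷ []) ∷ []

certificate783 : CosetFill.Certificate 27 29 bases783 (proj₁ design27) 9 4
certificate783 = record { wellFormed = _ ; differences = _ }

theorem2p8 : Exists2Design 459 9 4 × Exists2Design 783 9 4
theorem2p8 =
  (_ , CosetFill.Construction.design 27 17 bases459 (proj₁ design27) certificate459 (proj₂ design27)) ,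
  (_ , CosetFill.Construction.design 27 29 bases783 (proj₁ design27) certificate783 (proj₂ design27))
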